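{- Let $m$ be a positive integer with $d(m)\ge 4$, where $d(m)$ is the number of positive divisors of $m$, and let $d_1<d_2<\cdots<d_{d(m)}$ be the positive divisors of $m$ in increasing order. Define the $d(m)\times d(m)$ matrix $A=(A_{ij})$ by $$A_{ij}=\sum_{n=1}^{m/d_j}(d_j n)^{i-1},\qquad 1\le i,j\le d(m).$$ Then $A$ is singular. -}

module Defs where

open import Data.Nat using (ℕ; zero; suc; _+_; _*_; _^_)
open import Data.Nat.Divisibility using (_∣?_)
open import Data.Nat.DivMod using (_/_)
open import Data.List using (List; filter; length; lookup; upTo; map)
open import Data.Fin using (Fin; toℕ; punchIn)
import Data.Fin as F
open import Data.Integer using (ℤ; +_; -_)
open import Relation.Binary.PropositionalEquality using (_≡_; refl)
import Data.Integer as ℤ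

divisors : ℕ → List ℕ
divisors m = filter (_∣? m) (map suc (upTo m))

numDiv : ℕ → ℕ
numDiv m = length (divisors m)

-- the j-th divisor d_{j+1} (0-indexed)
divisor : (m : ℕ) → Fin (numDiv m) → ℕ
divisor m j = lookup (divisors m) j

-- m / d for d ≠ 0 (the d = 0 clause is never used, divisors are positive)
quot : ℕ → ℕ → ℕ
quot m zero    = 0
quot m (suc k) = m / suc k

sumFrom1 : ℕ → (ℕ → ℕ) → ℕ
sumFrom1 zero    f = 0
sumFrom1 (suc N) f = sumFrom1 N f + f (suc N)

-- A_{ij} = Σ_{n=1}^{m/d_j} (d_j n)^{i-1}, with 0-indexed i, j (so exponent = toℕ i)
matA : (m : ℕ) → Fin (numDiv m) → Fin (numDiv m) → ℤ
matA m i j = + sumFrom1 (quot m (divisor m j)) (λ n → (divisor m j * n) ^ toℕ i)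

sumFin : (n : ℕ) → (Fin n → ℤ) → ℤ
sumFin zero    f = + 0
sumFin (suc n) f = f F.zero ℤ.+ sumFin n (λ j → f (F.suc j))

sign : ℕ → ℤ
sign zero          = + 1
sign (suc zero)    = - (+ 1)
sign (suc (suc k)) = sign k

det : (n : ℕ) → (Fin n → Fin n → ℤ) → ℤ
det zero    M = + 1
det (suc n) M =
  sumFin (suc n) (λ j → sign (toℕ j) ℤ.* (M F.zero j ℤ.* det n (λ r c → M (F.suc r) (punchIn j c))))

Singular : (n : ℕ) → (Fin n → Fin n → ℤ) → Set
Singular n M = det n M ≡ + 0

module Submission where

-- In column j let d = d_j and N = m / d, so the entry in row i (counted from 0) is
-- s_i = Σ_{n ≤ N} (d n)^i. Faulhaber's formulas for Σ n, Σ n², Σ n³ give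
-- 2 s₃ + (dN)² s₁ = 3 (dN) s₂, and dN = m does not depend on j. So rows 1, 2, 3 satisfy one
-- linear relation with the non-zero coefficient 2 on row 3, which forces det A = 0.
--
-- Expanding twice shows that equal rows 0 and 1 give det 0: the terms for the
-- ordered column pairs (a, b) and (b, a) cancel. Equal rows p, q ≥ 1 then give det 0 through the
-- minors, and equal rows 0, q ≥ 2 are reduced to that case by swapping rows 0 and 1, which a
-- biadditive form vanishing on the diagonal allows.

open import Defs
open import Data.Fin using (Fin; zero; suc; toℕ; punchIn; punchOut; fromℕ<; _≟_)
open import Data.Product using (∃-syntax; _×_; _,_)
open import Function using (_∘_)
open import Relation.Nullary using (yes; no; contradiction)
open import Relation.Binary.PropositionalEquality

module PowerSums where

  open import Data.Nat using (ℕ; zero; suc; _+_; _*_; _^_)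
  open import Data.Nat.Properties using (*-zeroʳ; *-distribˡ-+; *-cancelˡ-≡)
  open import Data.Nat.Tactic.RingSolver using (solve-∀)
  open ≡-Reasoning

  sumFrom1-telescope : ∀ c (f F : ℕ → ℕ) → F 0 ≡ 0 → (∀ N → F N + c * f (suc N) ≡ F (suc N)) →
                       ∀ N → c * sumFrom1 N f ≡ F N
  sumFrom1-telescope c f F F0≡0 step zero = trans (*-zeroʳ c) (sym F0≡0)
  sumFrom1-telescope c f F F0≡0 step (suc N) = begin
    c * (sumFrom1 N f + f (suc N))     ≡⟨ *-distribˡ-+ c (sumFrom1 N f) (f (suc N)) ⟩
    c * sumFrom1 N f + c * f (suc N)   ≡⟨ cong (_+ c * f (suc N)) (sumFrom1-telescope c f F F0≡0 step N) ⟩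
    F N + c * f (suc N)                ≡⟨ step N ⟩
    F (suc N)                          ∎

  sumFrom1-scale : ∀ c (f g : ℕ → ℕ) → (∀ n → g n ≡ c * f n) →
                   ∀ N → sumFrom1 N g ≡ c * sumFrom1 N f
  sumFrom1-scale c f g g≡cf zero = sym (*-zeroʳ c)
  sumFrom1-scale c f g g≡cf (suc N) = begin
    sumFrom1 N g + g (suc N)           ≡⟨ cong₂ _+_ (sumFrom1-scale c f g g≡cf N) (g≡cf (suc N)) ⟩
    c * sumFrom1 N f + c * f (suc N)   ≡⟨ *-distribˡ-+ c (sumFrom1 N f) (f (suc N)) ⟨
    c * (sumFrom1 N f + f (suc N))     ∎

  ^-distrib-* : ∀ x y k → (x * y) ^ k ≡ x ^ k * y ^ k
  ^-distrib-* x y zero = refl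
  ^-distrib-* x y (suc k) = trans (cong (x * y *_) (^-distrib-* x y k)) (interchange x y (x ^ k) (y ^ k))
    where
    interchange : ∀ a b c d → a * b * (c * d) ≡ a * c * (b * d)
    interchange = solve-∀

  powerSum : ℕ → ℕ → ℕ
  powerSum k N = sumFrom1 N (λ n → n ^ k)

  faulhaber₁ : ∀ N → 2 * powerSum 1 N ≡ N * (1 + N)
  faulhaber₁ = sumFrom1-telescope 2 (_^ 1) (λ N → N * (1 + N)) refl step
    where
    step : ∀ N → N * (1 + N) + 2 * ((1 + N) * 1) ≡ (1 + N) * (1 + (1 + N))
    step = solve-∀

  faulhaber₂ : ∀ N → 6 * powerSum 2 N ≡ N * (1 + N) * (1 + 2 * N)
  faulhaber₂ = sumFrom1-telescope 6 (_^ 2) (λ N → N * (1 + N) * (1 + 2 * N)) refl step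
    where
    step : ∀ N → N * (1 + N) * (1 + 2 * N) + 6 * ((1 + N) * ((1 + N) * 1))
               ≡ (1 + N) * (1 + (1 + N)) * (1 + 2 * (1 + N))
    step = solve-∀

  faulhaber₃ : ∀ N → 4 * powerSum 3 N ≡ N * N * ((1 + N) * (1 + N))
  faulhaber₃ = sumFrom1-telescope 4 (_^ 3) (λ N → N * N * ((1 + N) * (1 + N))) refl step
    where
    step : ∀ N → N * N * ((1 + N) * (1 + N)) + 4 * ((1 + N) * ((1 + N) * ((1 + N) * 1)))
               ≡ (1 + N) * (1 + N) * ((1 + (1 + N)) * (1 + (1 + N)))
    step = solve-∀

  powerSum-relation : ∀ N → 2 * powerSum 3 N + N * N * powerSum 1 N ≡ 3 * N * powerSum 2 N
  powerSum-relation N = *-cancelˡ-≡ _ _ 12 (begin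
    12 * (2 * p₃ + N * N * p₁)                 ≡⟨ regroupˡ p₃ p₁ N ⟩
    6 * (4 * p₃) + 6 * (N * N) * (2 * p₁)      ≡⟨ cong₂ (λ x y → 6 * x + 6 * (N * N) * y)
                                                        (faulhaber₃ N) (faulhaber₁ N) ⟩
    6 * (N * N * ((1 + N) * (1 + N))) + 6 * (N * N) * (N * (1 + N))
                                               ≡⟨ closedForms N ⟩
    6 * N * (N * (1 + N) * (1 + 2 * N))        ≡⟨ cong (6 * N *_) (faulhaber₂ N) ⟨
    6 * N * (6 * p₂)                           ≡⟨ regroupʳ p₂ N ⟩
    12 * (3 * N * p₂)                          ∎)
    where
    p₁ = powerSum 1 N
    p₂ = powerSum 2 N
    p₃ = powerSum 3 N
    regroupˡ : ∀ p₃ p₁ N → 12 * (2 * p₃ + N * N * p₁) ≡ 6 * (4 * p₃) + 6 * (N * N) * (2 * p₁)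
    regroupˡ = solve-∀
    closedForms : ∀ N → 6 * (N * N * ((1 + N) * (1 + N))) + 6 * (N * N) * (N * (1 + N))
                      ≡ 6 * N * (N * (1 + N) * (1 + 2 * N))
    closedForms = solve-∀
    regroupʳ : ∀ p₂ N → 6 * N * (6 * p₂) ≡ 12 * (3 * N * p₂)
    regroupʳ = solve-∀

  -- The entry of matA m in row i and column j is + scaledPowerSum d_j (toℕ i) (m / d_j).
  scaledPowerSum : ℕ → ℕ → ℕ → ℕ
  scaledPowerSum d k N = sumFrom1 N (λ n → (d * n) ^ k)

  scaledPowerSum≡ : ∀ d k N → scaledPowerSum d k N ≡ d ^ k * powerSum k N
  scaledPowerSum≡ d k = sumFrom1-scale (d ^ k) (_^ k) (λ n → (d * n) ^ k) (λ n → ^-distrib-* d n k)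

  scaledPowerSum-relation : ∀ d N →
    2 * scaledPowerSum d 3 N + (d * N) * (d * N) * scaledPowerSum d 1 N
      ≡ 3 * (d * N) * scaledPowerSum d 2 N
  scaledPowerSum-relation d N = begin
    2 * s₃ + (d * N) * (d * N) * s₁       ≡⟨ cong₂ (λ x y → 2 * x + (d * N) * (d * N) * y)
                                                   (scaledPowerSum≡ d 3 N) (scaledPowerSum≡ d 1 N) ⟩
    2 * (d ^ 3 * p₃) + (d * N) * (d * N) * (d ^ 1 * p₁)
                                          ≡⟨ factorˡ d N p₁ p₃ ⟩
    d ^ 3 * (2 * p₃ + N * N * p₁)         ≡⟨ cong (d ^ 3 *_) (powerSum-relation N) ⟩
    d ^ 3 * (3 * N * p₂)                  ≡⟨ factorʳ d N p₂ ⟩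
    3 * (d * N) * (d ^ 2 * p₂)            ≡⟨ cong (3 * (d * N) *_) (scaledPowerSum≡ d 2 N) ⟨
    3 * (d * N) * s₂                      ∎
    where
    s₁ = scaledPowerSum d 1 N
    s₂ = scaledPowerSum d 2 N
    s₃ = scaledPowerSum d 3 N
    p₁ = powerSum 1 N
    p₂ = powerSum 2 N
    p₃ = powerSum 3 N
    factorˡ : ∀ d N p₁ p₃ → 2 * (d * (d * (d * 1)) * p₃) + (d * N) * (d * N) * (d * 1 * p₁)
                          ≡ d * (d * (d * 1)) * (2 * p₃ + N * N * p₁)
    factorˡ = solve-∀
    factorʳ : ∀ d N p₂ → d * (d * (d * 1)) * (3 * N * p₂) ≡ 3 * (d * N) * (d * (d * 1) * p₂)
    factorʳ = solve-∀

module Divisors where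

  open import Data.Nat using (suc; _*_)
  open import Data.Nat.Divisibility using (_∣_; _∣?_)
  open import Data.Nat.DivMod using (m*[n/m]≡n)
  open import Data.List using (map; upTo)
  open import Data.List.Membership.Propositional using (_∈_)
  open import Data.List.Membership.Propositional.Properties using (∈-lookup; ∈-map⁻; ∈-filter⁻)

  ∈-divisors⁻ : ∀ {m d} → d ∈ divisors m → ∃[ k ] d ≡ suc k × d ∣ m
  ∈-divisors⁻ {m} d∈divisors with ∈-filter⁻ (_∣? m) {xs = map suc (upTo m)} d∈divisors
  ... | d∈suc[upTo] , d∣m with ∈-map⁻ suc d∈suc[upTo]
  ...   | k , _ , d≡1+k = k , d≡1+k , d∣m

  divisor*quot≡m : ∀ m j → divisor m j * quot m (divisor m j) ≡ m
  divisor*quot≡m m j with ∈-divisors⁻ {m} (∈-lookup {xs = divisors m} j)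
  ... | k , d≡1+k , d∣m rewrite d≡1+k = m*[n/m]≡n d∣m

module Determinant where

  open import Data.Nat using (ℕ; zero; suc)
  open import Data.Integer using (ℤ; +_; -_; _+_; _*_; 0ℤ; -1ℤ; -[1+_]; NonZero)
  open import Data.Integer.Properties
    using (+-*-semiring; +-0-abelianGroup; *-cancelˡ-≡; -1*i≡-i; neg-involutive; +-identityˡ; *-zeroʳ)
  open import Data.Integer.Tactic.RingSolver using (solve-∀)
  open import Algebra.Properties.Semiring.Sum +-*-semiring
    using (sum; sum-syntax; sum-cong-≗; sum-replicate-zero; sum-remove; ∑-distrib-+; ∑-comm; *-distribˡ-sum)
  open import Algebra.Properties.AbelianGroup +-0-abelianGroup using (inverseˡ-unique)
  open import Data.Fin.Properties
    using (punchIn-punchOut; punchOut-punchIn; punchOut-cong; punchInᵢ≢i; suc-injective)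
  open import Data.Vec.Functional using (_∷_; zipWith; updateAt)
  open import Data.Vec.Functional.Properties using (updateAt-updates; updateAt-minimal)
  open ≡-Reasoning

  Row : ℕ → Set
  Row n = Fin n → ℤ

  Matrix : ℕ → Set
  Matrix n = Fin n → Row n

  sum-neg : ∀ {n} (f : Row n) → ∑[ i < n ] (- f i) ≡ - sum f
  sum-neg f = begin
    sum (λ i → - f i)          ≡⟨ sum-cong-≗ (λ i → -1*i≡-i (f i)) ⟨
    sum (λ i → -1ℤ * f i)      ≡⟨ *-distribˡ-sum -1ℤ f ⟨
    -1ℤ * sum f                ≡⟨ -1*i≡-i (sum f) ⟩
    - sum f                    ∎

  sum-linear : ∀ {n} (a b : ℤ) (f g : Row n) → ∑[ i < n ] (a * f i + b * g i) ≡ a * sum f + b * sum g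
  sum-linear a b f g = trans (∑-distrib-+ (λ i → a * f i) (λ i → b * g i))
                             (sym (cong₂ _+_ (*-distribˡ-sum a f) (*-distribˡ-sum b g)))

  x≡-x⇒x≡0 : ∀ x → x ≡ - x → x ≡ 0ℤ
  x≡-x⇒x≡0 (+ zero)  _ = refl
  x≡-x⇒x≡0 (+ suc _) ()
  x≡-x⇒x≡0 -[1+ _ ]  ()

  ∑∑-skew≡0 : ∀ {n} (h : Fin n → Fin n → ℤ) → (∀ a b → h a b ≡ - h b a) →
              ∑[ a < n ] ∑[ b < n ] h a b ≡ 0ℤ
  ∑∑-skew≡0 {n} h skew = x≡-x⇒x≡0 _ (begin
    ∑[ a < n ] ∑[ b < n ] h a b        ≡⟨ sum-cong-≗ (λ a → sum-cong-≗ (skew a)) ⟩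
    ∑[ a < n ] ∑[ b < n ] (- h b a)    ≡⟨ sum-cong-≗ (λ a → sum-neg (λ b → h b a)) ⟩
    ∑[ a < n ] (- ∑[ b < n ] h b a)    ≡⟨ sum-neg (λ a → ∑[ b < n ] h b a) ⟩
    - ∑[ a < n ] ∑[ b < n ] h b a      ≡⟨ cong -_ (∑-comm (λ a b → h b a)) ⟩
    - ∑[ b < n ] ∑[ a < n ] h b a      ∎)

  skew-of-alternating : ∀ {A : Set} (_⊕_ : A → A → A) (D : A → A → ℤ) →
    (∀ u v w → D (u ⊕ v) w ≡ D u w + D v w) → (∀ u v w → D u (v ⊕ w) ≡ D u v + D u w) →
    (∀ u → D u u ≡ 0ℤ) → ∀ u v → D u v ≡ - D v u
  skew-of-alternating _⊕_ D additiveˡ additiveʳ D-diag u v = inverseˡ-unique (D u v) (D v u) (begin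
    D u v + D v u                         ≡⟨ pad (D u v) (D v u) ⟩
    (0ℤ + D u v) + (D v u + 0ℤ)           ≡⟨ cong₂ (λ x y → (x + D u v) + (D v u + y))
                                                   (D-diag u) (D-diag v) ⟨
    (D u u + D u v) + (D v u + D v v)     ≡⟨ cong₂ _+_ (additiveʳ u u v) (additiveʳ v u v) ⟨
    D u (u ⊕ v) + D v (u ⊕ v)             ≡⟨ additiveˡ u v (u ⊕ v) ⟨
    D (u ⊕ v) (u ⊕ v)                     ≡⟨ D-diag (u ⊕ v) ⟩
    0ℤ                                    ∎)
    where
    pad : ∀ x y → x + y ≡ (0ℤ + x) + (y + 0ℤ)
    pad = solve-∀

  AgreeExcept : ∀ {n} → Fin n → Matrix n → Matrix n → Set
  AgreeExcept r A C = ∀ i → i ≢ r → A i ≗ C i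

  minor : ∀ {n} → Matrix (suc n) → Fin (suc n) → Matrix n
  minor M j r c = M (suc r) (punchIn j c)

  laplaceTerm : ∀ {n} → Matrix (suc n) → Fin (suc n) → ℤ
  laplaceTerm {n} M j = sign (toℕ j) * (M zero j * det n (minor M j))

  det-expand : ∀ n (M : Matrix (suc n)) → det (suc n) M ≡ ∑[ j < suc n ] laplaceTerm M j
  det-expand n M = sumFin≡sum (suc n) (laplaceTerm M)
    where
    sumFin≡sum : ∀ n (f : Row n) → sumFin n f ≡ sum f
    sumFin≡sum zero    f = refl
    sumFin≡sum (suc n) f = cong (_+_ (f zero)) (sumFin≡sum n (f ∘ suc))

  det-cong : ∀ n {M N : Matrix n} → (∀ i → M i ≗ N i) → det n M ≡ det n N
  det-cong zero    M≗N = refl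
  det-cong (suc n) {M} {N} M≗N = begin
    det (suc n) M                   ≡⟨ det-expand n M ⟩
    ∑[ j < suc n ] laplaceTerm M j  ≡⟨ sum-cong-≗ laplaceTerm-cong ⟩
    ∑[ j < suc n ] laplaceTerm N j  ≡⟨ det-expand n N ⟨
    det (suc n) N                   ∎
    where
    laplaceTerm-cong : ∀ j → laplaceTerm M j ≡ laplaceTerm N j
    laplaceTerm-cong j = cong₂ (λ x y → sign (toℕ j) * (x * y))
      (M≗N zero j) (det-cong n (λ r c → M≗N (suc r) (punchIn j c)))

  det-linear-row : ∀ n (r : Fin n) {A B C : Matrix n} (a b : ℤ) →
    (∀ c → C r c ≡ a * A r c + b * B r c) → AgreeExcept r A C → AgreeExcept r B C →
    det n C ≡ a * det n A + b * det n B
  laplaceTerm-linear-row : ∀ n (r : Fin (suc n)) {A B C : Matrix (suc n)} (a b : ℤ) →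
    (∀ c → C r c ≡ a * A r c + b * B r c) → AgreeExcept r A C → AgreeExcept r B C →
    ∀ j → laplaceTerm C j ≡ a * laplaceTerm A j + b * laplaceTerm B j

  det-linear-row (suc n) r {A} {B} {C} a b Cᵣ A≗C B≗C = begin
    det (suc n) C                                      ≡⟨ det-expand n C ⟩
    ∑[ j < suc n ] laplaceTerm C j                     ≡⟨ sum-cong-≗ (laplaceTerm-linear-row n r a b Cᵣ A≗C B≗C) ⟩
    ∑[ j < suc n ] (a * laplaceTerm A j + b * laplaceTerm B j)
                                                       ≡⟨ sum-linear a b (laplaceTerm A) (laplaceTerm B) ⟩
    a * sum (laplaceTerm A) + b * sum (laplaceTerm B)  ≡⟨ cong₂ (λ x y → a * x + b * y)
                                                                (det-expand n A) (det-expand n B) ⟨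
    a * det (suc n) A + b * det (suc n) B              ∎

  laplaceTerm-linear-row n zero {A} {B} {C} a b C₀ A≗C B≗C j = begin
    s * (C zero j * d)                              ≡⟨ cong (λ x → s * (x * d)) (C₀ j) ⟩
    s * ((a * A zero j + b * B zero j) * d)         ≡⟨ distribute s (A zero j) (B zero j) d a b ⟩
    a * (s * (A zero j * d)) + b * (s * (B zero j * d))
                                                    ≡⟨ cong₂ (λ x y → a * (s * (A zero j * x)) + b * (s * (B zero j * y)))
                                                             (minor-det A≗C) (minor-det B≗C) ⟨
    a * laplaceTerm A j + b * laplaceTerm B j       ∎
    where
    s = sign (toℕ j)
    d = det n (minor C j)
    minor-det : ∀ {X} → AgreeExcept zero X C → det n (minor X j) ≡ d
    minor-det X≗C = det-cong n (λ r → X≗C (suc r) (λ ()) ∘ punchIn j)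
    distribute : ∀ s x y d a b → s * ((a * x + b * y) * d) ≡ a * (s * (x * d)) + b * (s * (y * d))
    distribute = solve-∀
  laplaceTerm-linear-row (suc n) (suc r) {A} {B} {C} a b Cᵣ A≗C B≗C j = begin
    s * (C zero j * det (suc n) (minor C j))        ≡⟨ cong (λ y → s * (C zero j * y)) minor-linear ⟩
    s * (C zero j * (a * dA + b * dB))              ≡⟨ distribute s (C zero j) dA dB a b ⟩
    a * (s * (C zero j * dA)) + b * (s * (C zero j * dB))
                                                    ≡⟨ cong₂ (λ x y → a * (s * (x * dA)) + b * (s * (y * dB)))
                                                             (A≗C zero (λ ()) j) (B≗C zero (λ ()) j) ⟨
    a * laplaceTerm A j + b * laplaceTerm B j       ∎
    where
    s = sign (toℕ j)
    dA = det (suc n) (minor A j)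
    dB = det (suc n) (minor B j)
    minor-agree : ∀ {X} → AgreeExcept (suc r) X C → AgreeExcept r (minor X j) (minor C j)
    minor-agree X≗C i i≢r = X≗C (suc i) (i≢r ∘ suc-injective) ∘ punchIn j
    minor-linear : det (suc n) (minor C j) ≡ a * dA + b * dB
    minor-linear = det-linear-row (suc n) r a b (Cᵣ ∘ punchIn j) (minor-agree A≗C) (minor-agree B≗C)
    distribute : ∀ s x dA dB a b → s * (x * (a * dA + b * dB)) ≡ a * (s * (x * dA)) + b * (s * (x * dB))
    distribute = solve-∀

  det-additive-row : ∀ n (r : Fin n) {A B C : Matrix n} →
    (∀ c → C r c ≡ A r c + B r c) → AgreeExcept r A C → AgreeExcept r B C →
    det n C ≡ det n A + det n B
  det-additive-row n r {A} {B} {C} Cᵣ A≗C B≗C = begin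
    det n C                        ≡⟨ det-linear-row n r (+ 1) (+ 1) (λ c → trans (Cᵣ c) (unit (A r c) (B r c)))
                                                     A≗C B≗C ⟩
    + 1 * det n A + + 1 * det n B  ≡⟨ unit (det n A) (det n B) ⟨
    det n A + det n B              ∎
    where
    unit : ∀ x y → x + y ≡ + 1 * x + + 1 * y
    unit = solve-∀

  det-scale-row : ∀ n (r : Fin n) {A C : Matrix n} (a : ℤ) →
    (∀ c → C r c ≡ a * A r c) → AgreeExcept r A C → det n C ≡ a * det n A
  det-scale-row n r {A} {C} a Cᵣ A≗C = begin
    det n C                        ≡⟨ det-linear-row n r a 0ℤ (λ c → trans (Cᵣ c) (pad a (A r c))) A≗C A≗C ⟩
    a * det n A + 0ℤ * det n A     ≡⟨ pad a (det n A) ⟨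
    a * det n A                    ∎
    where
    pad : ∀ a x → a * x ≡ a * x + 0ℤ * x
    pad = solve-∀

  -- Both sides list the complement of {a, b} in increasing order.
  punchIn₂-comm : ∀ {k} {a b : Fin (suc (suc k))} (a≢b : a ≢ b) (b≢a : b ≢ a) (c : Fin k) →
    punchIn a (punchIn (punchOut a≢b) c) ≡ punchIn b (punchIn (punchOut b≢a) c)
  punchIn₂-comm {a = zero}  {zero}  a≢b _ _ = contradiction refl a≢b
  punchIn₂-comm {a = zero}  {suc b} _ _ _ = refl
  punchIn₂-comm {a = suc a} {zero}  _ _ _ = refl
  punchIn₂-comm {k = suc k} {suc a} {suc b} _ _ zero = refl
  punchIn₂-comm {k = suc k} {suc a} {suc b} a≢b b≢a (suc c) = cong suc (punchIn₂-comm _ _ c)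

  sign-suc : ∀ n → sign (suc n) ≡ - sign n
  sign-suc zero    = refl
  sign-suc (suc n) = sym (trans (cong -_ (sign-suc n)) (neg-involutive (sign n)))

  -- toℕ a + toℕ (punchOut a≢b) and toℕ b + toℕ (punchOut b≢a) differ by exactly one.
  sign-punchOut : ∀ {k} {a b : Fin (suc (suc k))} (a≢b : a ≢ b) (b≢a : b ≢ a) →
    sign (toℕ a) * sign (toℕ (punchOut a≢b)) ≡ - (sign (toℕ b) * sign (toℕ (punchOut b≢a)))
  sign-punchOut {a = zero}  {zero}  a≢b _ = contradiction refl a≢b
  sign-punchOut {a = zero}  {suc b} _ _ =
    trans (negate (sign (toℕ b))) (cong (λ x → - (x * + 1)) (sym (sign-suc (toℕ b))))
    where
    negate : ∀ s → + 1 * s ≡ - ((- s) * + 1)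
    negate = solve-∀
  sign-punchOut {a = suc a} {zero}  _ _ =
    trans (cong (λ x → x * + 1) (sign-suc (toℕ a))) (negate (sign (toℕ a)))
    where
    negate : ∀ s → (- s) * + 1 ≡ - (+ 1 * s)
    negate = solve-∀
  sign-punchOut {k = zero}  {suc zero} {suc zero} a≢b _ = contradiction refl a≢b
  sign-punchOut {k = suc k} {suc a} {suc b} a≢b b≢a = begin
    sign (suc (toℕ a)) * sign (suc (toℕ pa))      ≡⟨ sign-suc-* (toℕ a) (toℕ pa) ⟩
    sign (toℕ a) * sign (toℕ pa)                  ≡⟨ sign-punchOut (a≢b ∘ cong suc) (b≢a ∘ cong suc) ⟩
    - (sign (toℕ b) * sign (toℕ pb))              ≡⟨ cong -_ (sign-suc-* (toℕ b) (toℕ pb)) ⟨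
    - (sign (suc (toℕ b)) * sign (suc (toℕ pb)))  ∎
    where
    pa = punchOut {i = a} {j = b} (a≢b ∘ cong suc)
    pb = punchOut {i = b} {j = a} (b≢a ∘ cong suc)
    sign-suc-* : ∀ m n → sign (suc m) * sign (suc n) ≡ sign m * sign n
    sign-suc-* m n = trans (cong₂ _*_ (sign-suc m) (sign-suc n)) (neg-*-neg (sign m) (sign n))
      where
      neg-*-neg : ∀ x y → (- x) * (- y) ≡ x * y
      neg-*-neg = solve-∀

  module _ {k : ℕ} (M : Matrix (suc (suc k))) where

    twoRowTerm : Fin (suc (suc k)) → Fin (suc k) → ℤ
    twoRowTerm a c = sign (toℕ a) * (M zero a * laplaceTerm (minor M a) c)

    det-double-expand : det (suc (suc k)) M ≡ ∑[ a < suc (suc k) ] ∑[ c < suc k ] twoRowTerm a c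
    det-double-expand = trans (det-expand (suc k) M) (sum-cong-≗ laplaceTerm-expand)
      where
      laplaceTerm-expand : ∀ a → laplaceTerm M a ≡ ∑[ c < suc k ] twoRowTerm a c
      laplaceTerm-expand a = begin
        s * (M zero a * det (suc k) (minor M a))  ≡⟨ cong (λ x → s * (M zero a * x)) (det-expand k (minor M a)) ⟩
        s * (M zero a * sum t)                    ≡⟨ cong (s *_) (*-distribˡ-sum (M zero a) t) ⟩
        s * ∑[ c < suc k ] (M zero a * t c)       ≡⟨ *-distribˡ-sum s (λ c → M zero a * t c) ⟩
        ∑[ c < suc k ] twoRowTerm a c             ∎
        where
        s = sign (toℕ a)
        t = laplaceTerm (minor M a)

    -- twoRowTerm re-indexed by the actual column b = punchIn a c read in row 1, and 0 for b = a.
    pairTerm : Fin (suc (suc k)) → Fin (suc (suc k)) → ℤ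
    pairTerm a b with a ≟ b
    ... | yes _   = 0ℤ
    ... | no a≢b  = twoRowTerm a (punchOut a≢b)

    ∑-pairTerm : ∀ a → ∑[ b < suc (suc k) ] pairTerm a b ≡ ∑[ c < suc k ] twoRowTerm a c
    ∑-pairTerm a = begin
      sum (pairTerm a)                             ≡⟨ sum-remove {i = a} (pairTerm a) ⟩
      pairTerm a a + ∑[ c < suc k ] pairTerm a (punchIn a c)
                                                   ≡⟨ cong₂ _+_ pairTerm-diag (sum-cong-≗ pairTerm-punchIn) ⟩
      0ℤ + ∑[ c < suc k ] twoRowTerm a c           ≡⟨ +-identityˡ _ ⟩
      ∑[ c < suc k ] twoRowTerm a c                ∎
      where
      pairTerm-diag : pairTerm a a ≡ 0ℤ
      pairTerm-diag with a ≟ a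
      ... | yes _   = refl
      ... | no a≢a  = contradiction refl a≢a
      pairTerm-punchIn : ∀ c → pairTerm a (punchIn a c) ≡ twoRowTerm a c
      pairTerm-punchIn c with a ≟ punchIn a c
      ... | yes a≡a↑c = contradiction (sym a≡a↑c) (punchInᵢ≢i a c)
      ... | no a≢a↑c  = cong (twoRowTerm a) (trans (punchOut-cong a refl) (punchOut-punchIn a))

    module _ (M₀≗M₁ : M zero ≗ M (suc zero)) where

      twoRowTerm-pair : ∀ {a b} (a≢b : a ≢ b) → twoRowTerm a (punchOut a≢b) ≡
        (sign (toℕ a) * sign (toℕ (punchOut a≢b))) *
        (M zero a * M zero b * det k (minor (minor M a) (punchOut a≢b)))
      twoRowTerm-pair {a} {b} a≢b =
        trans (cong (λ x → sa * (M zero a * (sp * (x * D)))) row₁-entry) (regroup sa sp (M zero a) (M zero b) D)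
        where
        row₁-entry : M (suc zero) (punchIn a (punchOut a≢b)) ≡ M zero b
        row₁-entry = trans (cong (M (suc zero)) (punchIn-punchOut a≢b)) (sym (M₀≗M₁ b))
        sa = sign (toℕ a)
        sp = sign (toℕ (punchOut a≢b))
        D = det k (minor (minor M a) (punchOut a≢b))
        regroup : ∀ sa sp x y D → sa * (x * (sp * (y * D))) ≡ (sa * sp) * (x * y * D)
        regroup = solve-∀

      twoRowTerm-skew : ∀ {a b} (a≢b : a ≢ b) (b≢a : b ≢ a) →
        twoRowTerm a (punchOut a≢b) ≡ - twoRowTerm b (punchOut b≢a)
      twoRowTerm-skew {a} {b} a≢b b≢a = begin
        twoRowTerm a (punchOut a≢b)                ≡⟨ twoRowTerm-pair a≢b ⟩
        σab * (M zero a * M zero b * Dab)          ≡⟨ cong₂ (λ σ D → σ * (M zero a * M zero b * D))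
                                                            (sign-punchOut a≢b b≢a) D-sym ⟩
        - σba * (M zero a * M zero b * Dba)        ≡⟨ swap σba (M zero a) (M zero b) Dba ⟩
        - (σba * (M zero b * M zero a * Dba))      ≡⟨ cong -_ (twoRowTerm-pair b≢a) ⟨
        - twoRowTerm b (punchOut b≢a)              ∎
        where
        σab = sign (toℕ a) * sign (toℕ (punchOut a≢b))
        σba = sign (toℕ b) * sign (toℕ (punchOut b≢a))
        Dab = det k (minor (minor M a) (punchOut a≢b))
        Dba = det k (minor (minor M b) (punchOut b≢a))
        D-sym : Dab ≡ Dba
        D-sym = det-cong k (λ r c → cong (M (suc (suc r))) (punchIn₂-comm a≢b b≢a c))
        swap : ∀ σ x y D → - σ * (x * y * D) ≡ - (σ * (y * x * D))
        swap = solve-∀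

      pairTerm-skew : ∀ a b → pairTerm a b ≡ - pairTerm b a
      pairTerm-skew a b with a ≟ b | b ≟ a
      ... | yes _   | yes _   = refl
      ... | yes a≡b | no b≢a  = contradiction (sym a≡b) b≢a
      ... | no a≢b  | yes b≡a = contradiction (sym b≡a) a≢b
      ... | no a≢b  | no b≢a  = twoRowTerm-skew a≢b b≢a

      det-rows01 : det (suc (suc k)) M ≡ 0ℤ
      det-rows01 = begin
        det (suc (suc k)) M                                     ≡⟨ det-double-expand ⟩
        ∑[ a < suc (suc k) ] ∑[ c < suc k ] twoRowTerm a c      ≡⟨ sum-cong-≗ ∑-pairTerm ⟨
        ∑[ a < suc (suc k) ] ∑[ b < suc (suc k) ] pairTerm a b  ≡⟨ ∑∑-skew≡0 pairTerm pairTerm-skew ⟩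
        0ℤ                                                      ∎

  det-alternating : ∀ n (M : Matrix n) {p q : Fin n} → p ≢ q → M p ≗ M q → det n M ≡ 0ℤ
  det-alternating-suc : ∀ n (M : Matrix (suc n)) {p q : Fin n} → p ≢ q → M (suc p) ≗ M (suc q) →
                        det (suc n) M ≡ 0ℤ
  det-alternating-zero : ∀ n (M : Matrix (suc n)) (q : Fin n) → M zero ≗ M (suc q) →
                         det (suc n) M ≡ 0ℤ

  det-alternating (suc n) M {zero}  {zero}  p≢q _     = contradiction refl p≢q
  det-alternating (suc n) M {zero}  {suc q} _   M₀≗Mq = det-alternating-zero n M q M₀≗Mq
  det-alternating (suc n) M {suc p} {zero}  _   Mp≗M₀ = det-alternating-zero n M p (sym ∘ Mp≗M₀)
  det-alternating (suc n) M {suc p} {suc q} p≢q Mp≗Mq = det-alternating-suc n M (p≢q ∘ cong suc) Mp≗Mq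

  det-alternating-suc n M {p} {q} p≢q Mp≗Mq = begin
    det (suc n) M                    ≡⟨ det-expand n M ⟩
    ∑[ j < suc n ] laplaceTerm M j   ≡⟨ sum-cong-≗ laplaceTerm≡0 ⟩
    ∑[ j < suc n ] 0ℤ                ≡⟨ sum-replicate-zero (suc n) ⟩
    0ℤ                               ∎
    where
    laplaceTerm≡0 : ∀ j → laplaceTerm M j ≡ 0ℤ
    laplaceTerm≡0 j = trans (cong (λ x → sign (toℕ j) * (M zero j * x))
                                  (det-alternating n (minor M j) p≢q (Mp≗Mq ∘ punchIn j)))
                            (annihilate (sign (toℕ j)) (M zero j))
      where
      annihilate : ∀ s x → s * (x * 0ℤ) ≡ 0ℤ
      annihilate = solve-∀

  det-alternating-zero (suc k) M zero    M₀≗M₁ = det-rows01 M M₀≗M₁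
  -- D is alternating by the case above, hence skew; after swapping rows 0 and 1 the equal rows
  -- are 1 and q + 2, both in the minors.
  det-alternating-zero (suc k) M (suc q) M₀≗Mq = begin
    det (suc (suc k)) M          ≡⟨ det-cong (suc (suc k)) topRows ⟩
    D (M zero) (M (suc zero))    ≡⟨ skew-of-alternating (zipWith _+_) D additiveˡ additiveʳ D-diag
                                                        (M zero) (M (suc zero)) ⟩
    - D (M (suc zero)) (M zero)  ≡⟨ cong -_ (det-alternating-suc (suc k) swapped {zero} {suc q} (λ ()) M₀≗Mq) ⟩
    - 0ℤ                         ≡⟨⟩
    0ℤ                           ∎
    where
    R : Fin k → Row (suc (suc k))
    R i = M (suc (suc i))
    D : Row (suc (suc k)) → Row (suc (suc k)) → ℤ
    D u v = det (suc (suc k)) (u ∷ v ∷ R)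
    swapped : Matrix (suc (suc k))
    swapped = M (suc zero) ∷ M zero ∷ R
    topRows : ∀ i → M i ≗ (M zero ∷ M (suc zero) ∷ R) i
    topRows zero          _ = refl
    topRows (suc zero)    _ = refl
    topRows (suc (suc i)) _ = refl
    additiveˡ : ∀ u v w → D (zipWith _+_ u v) w ≡ D u w + D v w
    additiveˡ u v w = det-additive-row _ zero {u ∷ w ∷ R} {v ∷ w ∷ R} (λ _ → refl) off₀ off₀
      where
      off₀ : ∀ {x} → AgreeExcept zero (x ∷ w ∷ R) (zipWith _+_ u v ∷ w ∷ R)
      off₀ zero    0≢0 = contradiction refl 0≢0
      off₀ (suc i) _   _ = refl
    additiveʳ : ∀ u v w → D u (zipWith _+_ v w) ≡ D u v + D u w
    additiveʳ u v w = det-additive-row _ (suc zero) {u ∷ v ∷ R} {u ∷ w ∷ R} (λ _ → refl) off₁ off₁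
      where
      off₁ : ∀ {x} → AgreeExcept (suc zero) (u ∷ x ∷ R) (u ∷ zipWith _+_ v w ∷ R)
      off₁ zero          _   _ = refl
      off₁ (suc zero)    1≢1 = contradiction refl 1≢1
      off₁ (suc (suc i)) _   _ = refl
    D-diag : ∀ u → D u u ≡ 0ℤ
    D-diag u = det-rows01 (u ∷ u ∷ R) (λ _ → refl)

  det-zero-of-row-relation : ∀ n (M : Matrix n) {r p q : Fin n} (c a b : ℤ) .{{_ : NonZero c}} →
    r ≢ p → r ≢ q → (∀ j → c * M r j + b * M q j ≡ a * M p j) → det n M ≡ 0ℤ
  det-zero-of-row-relation n M {r} {p} {q} c a b r≢p r≢q relation = *-cancelˡ-≡ c (det n M) 0ℤ (begin
    c * det n M                              ≡⟨ pad c (det n M) b ⟩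
    c * det n M + b * 0ℤ                     ≡⟨ cong (λ x → c * det n M + b * x) (copy≡0 r≢q) ⟨
    c * det n M + b * det n (withRow (M q))  ≡⟨ det-linear-row n r c b combined-row
                                                  (λ i i≢r → sym ∘ withRow-off _ i≢r) (λ i → withRow-agree) ⟨
    det n (withRow (λ j → a * M p j))        ≡⟨ det-scale-row n r a scaled-row (λ i → withRow-agree) ⟩
    a * det n (withRow (M p))                ≡⟨ cong (a *_) (copy≡0 r≢p) ⟩
    a * 0ℤ                                   ≡⟨ trans (*-zeroʳ a) (sym (*-zeroʳ c)) ⟩
    c * 0ℤ                                   ∎)
    where
    withRow : Row n → Matrix n
    withRow u = updateAt M r (λ _ → u)
    withRow-at : ∀ u → withRow u r ≗ u
    withRow-at u = cong-app (updateAt-updates r M)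
    withRow-off : ∀ u {i} → i ≢ r → withRow u i ≗ M i
    withRow-off u {i} i≢r = cong-app (updateAt-minimal i r M i≢r)
    withRow-agree : ∀ {u v i} → i ≢ r → withRow u i ≗ withRow v i
    withRow-agree {u} {v} i≢r j = trans (withRow-off u i≢r j) (sym (withRow-off v i≢r j))
    copy≡0 : ∀ {s} → r ≢ s → det n (withRow (M s)) ≡ 0ℤ
    copy≡0 {s} r≢s = det-alternating n (withRow (M s)) r≢s
      (λ j → trans (withRow-at (M s) j) (sym (withRow-off (M s) (r≢s ∘ sym) j)))
    combined-row : ∀ j → withRow (λ j → a * M p j) r j ≡ c * M r j + b * withRow (M q) r j
    combined-row j = begin
      withRow (λ j → a * M p j) r j     ≡⟨ withRow-at _ j ⟩
      a * M p j                         ≡⟨ relation j ⟨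
      c * M r j + b * M q j             ≡⟨ cong (λ x → c * M r j + b * x) (withRow-at (M q) j) ⟨
      c * M r j + b * withRow (M q) r j ∎
    scaled-row : ∀ j → withRow (λ j → a * M p j) r j ≡ a * withRow (M p) r j
    scaled-row j = trans (withRow-at _ j) (cong (a *_) (sym (withRow-at (M p) j)))
    pad : ∀ c x b → c * x ≡ c * x + b * 0ℤ
    pad = solve-∀

open PowerSums using (scaledPowerSum; scaledPowerSum-relation)
open Divisors using (divisor*quot≡m)
open Determinant using (det-zero-of-row-relation)

open import Data.Nat using (ℕ; _≤_; _<_; s≤s; z≤n)
import Data.Nat as ℕ
open import Data.Integer using (+_; _+_; _*_)
open import Data.Integer.Properties using (pos-+; pos-*)
open import Data.Nat.Properties using (≤-trans)
open import Data.Fin.Properties using (fromℕ<-injective; toℕ-fromℕ<)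

matA-row-relation : ∀ m (i₁ i₂ i₃ : Fin (numDiv m)) → toℕ i₁ ≡ 1 → toℕ i₂ ≡ 2 → toℕ i₃ ≡ 3 →
  ∀ j → + 2 * matA m i₃ j + + (m ℕ.* m) * matA m i₁ j ≡ + (3 ℕ.* m) * matA m i₂ j
matA-row-relation m i₁ i₂ i₃ i₁≡1 i₂≡2 i₃≡3 j rewrite i₁≡1 | i₂≡2 | i₃≡3 = begin
  + 2 * + s₃ + + (m ℕ.* m) * + s₁        ≡⟨ cong₂ _+_ (pos-* 2 s₃) (pos-* (m ℕ.* m) s₁) ⟨
  + (2 ℕ.* s₃) + + (m ℕ.* m ℕ.* s₁)      ≡⟨ pos-+ (2 ℕ.* s₃) (m ℕ.* m ℕ.* s₁) ⟨
  + (2 ℕ.* s₃ ℕ.+ m ℕ.* m ℕ.* s₁)        ≡⟨ cong +_ relation ⟩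
  + (3 ℕ.* m ℕ.* s₂)                     ≡⟨ pos-* (3 ℕ.* m) s₂ ⟩
  + (3 ℕ.* m) * + s₂                     ∎
  where
  open ≡-Reasoning
  d = divisor m j
  s₁ = scaledPowerSum d 1 (quot m d)
  s₂ = scaledPowerSum d 2 (quot m d)
  s₃ = scaledPowerSum d 3 (quot m d)
  relation : 2 ℕ.* s₃ ℕ.+ m ℕ.* m ℕ.* s₁ ≡ 3 ℕ.* m ℕ.* s₂
  relation = subst (λ x → 2 ℕ.* s₃ ℕ.+ x ℕ.* x ℕ.* s₁ ≡ 3 ℕ.* x ℕ.* s₂)
                   (divisor*quot≡m m j) (scaledPowerSum-relation d (quot m d))

mainTheorem2 : (m : ℕ) → 0 < m → 4 ≤ numDiv m → Singular (numDiv m) (matA m)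
mainTheorem2 m _ 3<d = det-zero-of-row-relation (numDiv m) (matA m) (+ 2) (+ (3 ℕ.* m)) (+ (m ℕ.* m))
  i₃≢i₂ i₃≢i₁ (matA-row-relation m i₁ i₂ i₃ (toℕ-fromℕ< 1<d) (toℕ-fromℕ< 2<d) (toℕ-fromℕ< 3<d))
  where
  2<d : 2 < numDiv m
  2<d = ≤-trans (s≤s (s≤s (s≤s z≤n))) 3<d
  1<d : 1 < numDiv m
  1<d = ≤-trans (s≤s (s≤s z≤n)) 3<d
  i₁ i₂ i₃ : Fin (numDiv m)
  i₁ = fromℕ< 1<d
  i₂ = fromℕ< 2<d
  i₃ = fromℕ< 3<d
  i₃≢i₂ : i₃ ≢ i₂
  i₃≢i₂ = (λ ()) ∘ fromℕ<-injective 3 2 3<d 2<d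
  i₃≢i₁ : i₃ ≢ i₁
  i₃≢i₁ = (λ ()) ∘ fromℕ<-injective 3 1 3<d 1<d
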